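{- Let $m>7$ be an integer and let $D_m$ be the $0$-$1$ matrix $$D_m=\left(\binom{i+1+j}{j}+1 \bmod 2\right)_{2^{m-3}-\frac{14}{2^4}2^{m-3}\le i<2^{m-3},\ 0\le j<\frac{1}{2^4}2^{m-3}}$$ (of size $14\cdot 2^{m-7}\times 2^{m-7}$). Then the proportion of entries of $D_m$ equal to $1$ is exactly $1-\left(\tfrac34\right)^{m-7}$.
   Context: Here $x\bmod 2\in\{0,1\}$ denotes the residue of the integer $x$ modulo $2$. -}

module Defs where

open import Data.Nat using (ℕ; suc; _+_; _*_; _∸_; _^_; _≟_)
open import Data.Nat.DivMod using (_%_)
open import Data.Nat.Combinatorics using (_C_)
open import Data.List using (List; map; upTo; concatMap; filter; length)
open import Data.Product using (_×_; _,_; proj₁; proj₂)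

entry : ℕ → ℕ → ℕ
entry i j = (((suc i + j) C j) + 1) % 2

-- Row range: 2^(m-3) - (14/2^4) 2^(m-3) ≤ i < 2^(m-3); for m > 7 the lower bound is
-- the integer 2^(m-3) - 14 * 2^(m-7).
rowLow : ℕ → ℕ
rowLow m = 2 ^ (m ∸ 3) ∸ 14 * 2 ^ (m ∸ 7)

rowHigh : ℕ → ℕ
rowHigh m = 2 ^ (m ∸ 3)

-- Column range: 0 ≤ j < (1/2^4) 2^(m-3) = 2^(m-7) (for m > 7).
colHigh : ℕ → ℕ
colHigh m = 2 ^ (m ∸ 7)

rows : ℕ → List ℕ
rows m = map (rowLow m +_) (upTo (rowHigh m ∸ rowLow m))

cols : ℕ → List ℕ
cols m = upTo (colHigh m)

indices : ℕ → List (ℕ × ℕ)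
indices m = concatMap (λ i → map (λ j → (i , j)) (cols m)) (rows m)

numEntries : ℕ → ℕ
numEntries m = length (indices m)

numOnes : ℕ → ℕ
numOnes m = length (filter (λ p → entry (proj₁ p) (proj₂ p) ≟ 1) (indices m))

-- Entry (i, j) of D_m is 1 exactly when C(i + 1 + j, j) is even. By Lucas's theorem C(a + j, j)
-- is odd iff adding a and j in binary has no carry. Hence for j < 2^n its parity is 2^n-periodic
-- in a, and among a, j < 2^n exactly 3^n pairs give an odd coefficient (every digit pair except
-- (1, 1) is allowed). The 14 * 2^n consecutive rows of D_m therefore contain 14 * 3^n odd
-- coefficients among their 14 * 4^n entries.
module Submission where

open import Defs
open import Data.Bool using (Bool; true; false; _xor_)
open import Data.Bool.Properties using (xor-same; xor-identityʳ)
open import Data.List using (List; []; _∷_; _++_; map; upTo; applyUpTo; concatMap; filter; length)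
open import Data.List.Properties using (map-++; map-upTo)
open import Data.Nat using (ℕ; zero; suc; _+_; _*_; _∸_; _^_; _<_; _≟_; z≤n; s≤s)
open import Data.Nat.Combinatorics using (_C_; nCk+nC[k+1]≡[n+1]C[k+1]; k>n⇒nCk≡0)
open import Data.Nat.DivMod using (_%_; %-distribˡ-+)
open import Data.Nat.ListAction using (sum)
open import Data.Nat.ListAction.Properties using (sum-++)
open import Data.Nat.Properties
open import Algebra.Properties.CommutativeSemigroup +-commutativeSemigroup using (interchange)
open import Data.Product using (_×_; _,_)
open import Function using (_∘_; const)
open import Relation.Nullary using (does)
open import Relation.Unary using (Pred; Decidable)
open import Relation.Binary.PropositionalEquality
open ≡-Reasoning

𝟙 : Bool → ℕ
𝟙 true  = 1
𝟙 false = 0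

𝟙-xor : ∀ x y → (𝟙 x + 𝟙 y) % 2 ≡ 𝟙 (x xor y)
𝟙-xor true  true  = refl
𝟙-xor true  false = refl
𝟙-xor false true  = refl
𝟙-xor false false = refl

pascal₂ : ℕ → ℕ → Bool
pascal₂ zero    zero    = true
pascal₂ zero    (suc k) = false
pascal₂ (suc n) zero    = true
pascal₂ (suc n) (suc k) = pascal₂ n k xor pascal₂ n (suc k)

pascal₂-zero : ∀ n → pascal₂ n 0 ≡ true
pascal₂-zero zero    = refl
pascal₂-zero (suc n) = refl

C-mod-2 : ∀ n k → (n C k) % 2 ≡ 𝟙 (pascal₂ n k)
C-mod-2 zero    zero    = refl
C-mod-2 zero    (suc k) = cong (_% 2) (k>n⇒nCk≡0 {0} {suc k} (s≤s z≤n))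
C-mod-2 (suc n) zero    = refl
C-mod-2 (suc n) (suc k) = begin
  (suc n C suc k) % 2                   ≡⟨ cong (_% 2) (nCk+nC[k+1]≡[n+1]C[k+1] n k) ⟨
  (n C k + n C suc k) % 2               ≡⟨ %-distribˡ-+ (n C k) (n C suc k) 2 ⟩
  ((n C k) % 2 + (n C suc k) % 2) % 2   ≡⟨ cong₂ (λ x y → (x + y) % 2) (C-mod-2 n k) (C-mod-2 n (suc k)) ⟩
  (𝟙 (pascal₂ n k) + 𝟙 (pascal₂ n (suc k))) % 2 ≡⟨ 𝟙-xor (pascal₂ n k) (pascal₂ n (suc k)) ⟩
  𝟙 (pascal₂ (suc n) (suc k))           ∎

double : ℕ → ℕ
double zero    = zero
double (suc n) = suc (suc (double n))

data Half : ℕ → Set where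
  even : ∀ k → Half (double k)
  odd  : ∀ k → Half (suc (double k))

half : ∀ n → Half n
half zero = even zero
half (suc n) with half n
... | even k = odd k
... | odd  k = even (suc k)

double-+ : ∀ m n → double m + double n ≡ double (m + n)
double-+ zero    n = refl
double-+ (suc m) n = cong (suc ∘ suc) (double-+ m n)

double-cancel-< : ∀ {m n} → double m < double n → m < n
double-cancel-< {zero}  {suc n} _                 = s≤s z≤n
double-cancel-< {suc m} {suc n} (s≤s (s≤s m<n)) = s≤s (double-cancel-< m<n)

suc-double-cancel-< : ∀ {m n} → suc (double m) < double n → m < n
suc-double-cancel-< {m} = double-cancel-< ∘ <-trans (n<1+n (double m))

double≡2* : ∀ n → double n ≡ 2 * n
double≡2* zero    = refl
double≡2* (suc n) = cong suc (trans (cong suc (double≡2* n)) (sym (+-suc n (n + 0))))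

-- Lucas's theorem for p = 2, one binary digit at a time.
pascal₂-even-even : ∀ n k → pascal₂ (double n) (double k) ≡ pascal₂ n k
pascal₂-even-odd  : ∀ n k → pascal₂ (double n) (suc (double k)) ≡ false
pascal₂-odd-even  : ∀ n k → pascal₂ (suc (double n)) (double k) ≡ pascal₂ n k
pascal₂-odd-odd   : ∀ n k → pascal₂ (suc (double n)) (suc (double k)) ≡ pascal₂ n k

pascal₂-even-even zero    zero    = refl
pascal₂-even-even zero    (suc k) = refl
pascal₂-even-even (suc n) zero    = refl
pascal₂-even-even (suc n) (suc k) = cong₂ _xor_ (pascal₂-odd-odd n k) (pascal₂-odd-even n (suc k))

pascal₂-even-odd zero    k = refl
pascal₂-even-odd (suc n) k =
  trans (cong₂ _xor_ (pascal₂-odd-even n k) (pascal₂-odd-odd n k)) (xor-same (pascal₂ n k))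

pascal₂-odd-even zero    zero    = refl
pascal₂-odd-even zero    (suc k) = refl
pascal₂-odd-even (suc n) zero    = refl
pascal₂-odd-even (suc n) (suc k) = cong₂ _xor_ (pascal₂-even-odd (suc n) k) (pascal₂-even-even (suc n) (suc k))

pascal₂-odd-odd zero    zero    = refl
pascal₂-odd-odd zero    (suc k) = refl
pascal₂-odd-odd (suc n) k =
  trans (cong₂ _xor_ (pascal₂-even-even (suc n) k) (pascal₂-even-odd (suc n) k)) (xor-identityʳ _)

binomOdd : ℕ → ℕ → Bool
binomOdd a j = pascal₂ (a + j) j

double-+-suc : ∀ a j → double a + suc (double j) ≡ suc (double (a + j))
double-+-suc a j = trans (+-suc (double a) (double j)) (cong suc (double-+ a j))

binomOdd-even-even : ∀ a j → binomOdd (double a) (double j) ≡ binomOdd a j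
binomOdd-even-even a j = trans (cong (λ x → pascal₂ x (double j)) (double-+ a j)) (pascal₂-even-even (a + j) j)

binomOdd-odd-even : ∀ a j → binomOdd (suc (double a)) (double j) ≡ binomOdd a j
binomOdd-odd-even a j = trans (cong (λ x → pascal₂ (suc x) (double j)) (double-+ a j)) (pascal₂-odd-even (a + j) j)

binomOdd-even-odd : ∀ a j → binomOdd (double a) (suc (double j)) ≡ binomOdd a j
binomOdd-even-odd a j = trans (cong (λ x → pascal₂ x (suc (double j))) (double-+-suc a j)) (pascal₂-odd-odd (a + j) j)

binomOdd-odd-odd : ∀ a j → binomOdd (suc (double a)) (suc (double j)) ≡ false
binomOdd-odd-odd a j = trans (cong (λ x → pascal₂ (suc x) (suc (double j))) (double-+-suc a j)) (pascal₂-even-odd (suc (a + j)) j)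

binomOdd-period-double : ∀ N → (∀ a j → j < N → binomOdd (a + N) j ≡ binomOdd a j) →
                         ∀ a j → j < double N → binomOdd (a + double N) j ≡ binomOdd a j
binomOdd-period-double N period a j j<2N with half a | half j
... | even a | even j = begin
  binomOdd (double a + double N) (double j) ≡⟨ cong (λ x → binomOdd x (double j)) (double-+ a N) ⟩
  binomOdd (double (a + N)) (double j)      ≡⟨ binomOdd-even-even (a + N) j ⟩
  binomOdd (a + N) j                        ≡⟨ period a j (double-cancel-< j<2N) ⟩
  binomOdd a j                              ≡⟨ binomOdd-even-even a j ⟨
  binomOdd (double a) (double j)            ∎
... | even a | odd j = begin
  binomOdd (double a + double N) (suc (double j)) ≡⟨ cong (λ x → binomOdd x (suc (double j))) (double-+ a N) ⟩
  binomOdd (double (a + N)) (suc (double j))      ≡⟨ binomOdd-even-odd (a + N) j ⟩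
  binomOdd (a + N) j                              ≡⟨ period a j (suc-double-cancel-< j<2N) ⟩
  binomOdd a j                                    ≡⟨ binomOdd-even-odd a j ⟨
  binomOdd (double a) (suc (double j))            ∎
... | odd a | even j = begin
  binomOdd (suc (double a + double N)) (double j) ≡⟨ cong (λ x → binomOdd (suc x) (double j)) (double-+ a N) ⟩
  binomOdd (suc (double (a + N))) (double j)      ≡⟨ binomOdd-odd-even (a + N) j ⟩
  binomOdd (a + N) j                              ≡⟨ period a j (double-cancel-< j<2N) ⟩
  binomOdd a j                                    ≡⟨ binomOdd-odd-even a j ⟨
  binomOdd (suc (double a)) (double j)            ∎
... | odd a | odd j = begin
  binomOdd (suc (double a + double N)) (suc (double j)) ≡⟨ cong (λ x → binomOdd (suc x) (suc (double j))) (double-+ a N) ⟩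
  binomOdd (suc (double (a + N))) (suc (double j))      ≡⟨ binomOdd-odd-odd (a + N) j ⟩
  false                                                 ≡⟨ binomOdd-odd-odd a j ⟨
  binomOdd (suc (double a)) (suc (double j))            ∎

2^suc≡double : ∀ n → 2 ^ suc n ≡ double (2 ^ n)
2^suc≡double n = sym (double≡2* (2 ^ n))

binomOdd-period : ∀ n a j → j < 2 ^ n → binomOdd (a + 2 ^ n) j ≡ binomOdd a j
binomOdd-period zero    a zero    _ = trans (pascal₂-zero (a + 1 + 0)) (sym (pascal₂-zero (a + 0)))
binomOdd-period zero    a (suc j) (s≤s ())
binomOdd-period (suc n) a j j<2^n+1 = subst (λ N → binomOdd (a + N) j ≡ binomOdd a j) (sym (2^suc≡double n))
  (binomOdd-period-double (2 ^ n) (binomOdd-period n) a j (subst (j <_) (2^suc≡double n) j<2^n+1))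

∑ : ℕ → (ℕ → ℕ) → ℕ
∑ zero    f = 0
∑ (suc n) f = f 0 + ∑ n (f ∘ suc)

syntax ∑ n (λ x → e) = ∑[ x < n ] e

∑-cong : ∀ n {f g : ℕ → ℕ} → (∀ x → x < n → f x ≡ g x) → ∑ n f ≡ ∑ n g
∑-cong zero    eq = refl
∑-cong (suc n) eq = cong₂ _+_ (eq 0 (s≤s z≤n)) (∑-cong n (λ x x<n → eq (suc x) (s≤s x<n)))

∑-distrib-+ : ∀ n (f g : ℕ → ℕ) → ∑[ x < n ] (f x + g x) ≡ ∑ n f + ∑ n g
∑-distrib-+ zero    f g = refl
∑-distrib-+ (suc n) f g =
  trans (cong (f 0 + g 0 +_) (∑-distrib-+ n (f ∘ suc) (g ∘ suc))) (interchange (f 0) (g 0) _ _)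

∑-distribˡ-* : ∀ n c (f : ℕ → ℕ) → ∑[ x < n ] (c * f x) ≡ c * ∑ n f
∑-distribˡ-* zero    c f = sym (*-zeroʳ c)
∑-distribˡ-* (suc n) c f =
  trans (cong (c * f 0 +_) (∑-distribˡ-* n c (f ∘ suc))) (sym (*-distribˡ-+ c (f 0) _))

∑-const : ∀ n c → ∑[ _ < n ] c ≡ n * c
∑-const zero    c = refl
∑-const (suc n) c = cong (c +_) (∑-const n c)

∑-split : ∀ m n (f : ℕ → ℕ) → ∑ (m + n) f ≡ ∑ m f + ∑[ x < n ] f (m + x)
∑-split zero    n f = refl
∑-split (suc m) n f = trans (cong (f 0 +_) (∑-split m n (f ∘ suc))) (sym (+-assoc (f 0) _ _))

∑-snoc : ∀ n (f : ℕ → ℕ) → ∑ (suc n) f ≡ ∑ n f + f n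
∑-snoc zero    f = +-identityʳ (f 0)
∑-snoc (suc n) f = trans (cong (f 0 +_) (∑-snoc n (f ∘ suc))) (sym (+-assoc (f 0) _ _))

∑-double : ∀ n (f : ℕ → ℕ) → ∑ (double n) f ≡ ∑[ x < n ] (f (double x) + f (suc (double x)))
∑-double zero    f = refl
∑-double (suc n) f = trans (sym (+-assoc (f 0) (f 1) _)) (cong (f 0 + f 1 +_) (∑-double n (f ∘ suc ∘ suc)))

∑∑-double : ∀ n (f : ℕ → ℕ → ℕ) →
  ∑[ a < double n ] ∑[ j < double n ] f a j ≡
  ∑[ a < n ] ∑[ j < n ] ((f (double a) (double j) + f (double a) (suc (double j))) +
                        (f (suc (double a)) (double j) + f (suc (double a)) (suc (double j))))
∑∑-double n f = trans (∑-double n _) (∑-cong n (λ a _ → begin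
  ∑ (double n) (f (double a)) + ∑ (double n) (f (suc (double a)))
    ≡⟨ cong₂ _+_ (∑-double n (f (double a))) (∑-double n (f (suc (double a)))) ⟩
  (∑[ j < n ] (f (double a) (double j) + f (double a) (suc (double j)))) +
  (∑[ j < n ] (f (suc (double a)) (double j) + f (suc (double a)) (suc (double j))))
    ≡⟨ ∑-distrib-+ n _ _ ⟨
  _ ∎))

∑-rotate : ∀ n (f : ℕ → ℕ) → f n ≡ f 0 → ∑[ x < n ] f (suc x) ≡ ∑ n f
∑-rotate n f fn≡f0 = +-cancelˡ-≡ (f 0) _ _ (begin
  ∑ (suc n) f  ≡⟨ ∑-snoc n f ⟩
  ∑ n f + f n  ≡⟨ cong (∑ n f +_) fn≡f0 ⟩
  ∑ n f + f 0  ≡⟨ +-comm (∑ n f) (f 0) ⟩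
  f 0 + ∑ n f  ∎)

module _ {n} {f : ℕ → ℕ} (periodic : ∀ x → f (x + n) ≡ f x) where

  ∑-periodic-shift : ∀ c → ∑[ x < n ] f (c + x) ≡ ∑ n f
  ∑-periodic-shift zero    = refl
  ∑-periodic-shift (suc c) = begin
    ∑[ x < n ] f (suc c + x) ≡⟨ ∑-cong n (λ x _ → cong f (+-suc c x)) ⟨
    ∑[ x < n ] f (c + suc x) ≡⟨ ∑-rotate n (f ∘ (c +_)) (trans (periodic c) (cong f (sym (+-identityʳ c)))) ⟩
    ∑[ x < n ] f (c + x)     ≡⟨ ∑-periodic-shift c ⟩
    ∑ n f                    ∎

  ∑-periodic-blocks : ∀ k c → ∑[ x < k * n ] f (c + x) ≡ k * ∑ n f
  ∑-periodic-blocks zero    c = refl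
  ∑-periodic-blocks (suc k) c = begin
    ∑[ x < n + k * n ] f (c + x)                            ≡⟨ ∑-split n (k * n) _ ⟩
    ∑[ x < n ] f (c + x) + ∑[ x < k * n ] f (c + (n + x))  ≡⟨ cong₂ _+_ (∑-periodic-shift c)
                                                                 (∑-cong (k * n) (λ x _ → cong f (sym (+-assoc c n x)))) ⟩
    ∑ n f + ∑[ x < k * n ] f (c + n + x)                    ≡⟨ cong (∑ n f +_) (∑-periodic-blocks k (c + n)) ⟩
    ∑ n f + k * ∑ n f                                       ∎

oddInRow : ℕ → ℕ → ℕ
oddInRow N a = ∑[ j < N ] 𝟙 (binomOdd a j)

-- Of the four pairs of lowest binary digits of (a, j) only (1, 1) produces a carry.
binomOdd-lowest-digits : ∀ a j →
  (𝟙 (binomOdd (double a) (double j)) + 𝟙 (binomOdd (double a) (suc (double j)))) +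
  (𝟙 (binomOdd (suc (double a)) (double j)) + 𝟙 (binomOdd (suc (double a)) (suc (double j))))
  ≡ 3 * 𝟙 (binomOdd a j)
binomOdd-lowest-digits a j = count-digits (binomOdd-even-even a j) (binomOdd-even-odd a j)
                                          (binomOdd-odd-even a j) (binomOdd-odd-odd a j)
  where
  count-digits : ∀ {p q r s o} → p ≡ o → q ≡ o → r ≡ o → s ≡ false → (𝟙 p + 𝟙 q) + (𝟙 r + 𝟙 s) ≡ 3 * 𝟙 o
  count-digits {o = true}  refl refl refl refl = refl
  count-digits {o = false} refl refl refl refl = refl

oddInRows-double : ∀ N → ∑[ a < double N ] oddInRow (double N) a ≡ 3 * ∑[ a < N ] oddInRow N a
oddInRows-double N = begin
  ∑[ a < double N ] oddInRow (double N) a       ≡⟨ ∑∑-double N (λ a j → 𝟙 (binomOdd a j)) ⟩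
  _                                             ≡⟨ ∑-cong N (λ a _ → ∑-cong N (λ j _ → binomOdd-lowest-digits a j)) ⟩
  ∑[ a < N ] ∑[ j < N ] (3 * 𝟙 (binomOdd a j))  ≡⟨ ∑-cong N (λ a _ → ∑-distribˡ-* N 3 _) ⟩
  ∑[ a < N ] (3 * oddInRow N a)                 ≡⟨ ∑-distribˡ-* N 3 _ ⟩
  3 * ∑[ a < N ] oddInRow N a                   ∎

oddInRows-2^ : ∀ n → ∑[ a < 2 ^ n ] oddInRow (2 ^ n) a ≡ 3 ^ n
oddInRows-2^ zero    = refl
oddInRows-2^ (suc n) rewrite 2^suc≡double n = trans (oddInRows-double (2 ^ n)) (cong (3 *_) (oddInRows-2^ n))

oddInRow-period : ∀ n a → oddInRow (2 ^ n) (a + 2 ^ n) ≡ oddInRow (2 ^ n) a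
oddInRow-period n a = ∑-cong (2 ^ n) (λ j j<2^n → cong 𝟙 (binomOdd-period n a j j<2^n))

oddInConsecutiveRows : ∀ n k c → ∑[ r < k * 2 ^ n ] oddInRow (2 ^ n) (c + r) ≡ k * 3 ^ n
oddInConsecutiveRows n k c =
  trans (∑-periodic-blocks (oddInRow-period n) k c) (cong (k *_) (oddInRows-2^ n))

module _ {a p} {A : Set a} {P : Pred A p} (P? : Decidable P) where

  length-filter≡sum-map-𝟙 : ∀ xs → length (filter P? xs) ≡ sum (map (𝟙 ∘ does ∘ P?) xs)
  length-filter≡sum-map-𝟙 []       = refl
  length-filter≡sum-map-𝟙 (x ∷ xs) with does (P? x)
  ... | true  = cong suc (length-filter≡sum-map-𝟙 xs)
  ... | false = length-filter≡sum-map-𝟙 xs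

length≡sum-map-const-1 : ∀ {a} {A : Set a} (xs : List A) → length xs ≡ sum (map (const 1) xs)
length≡sum-map-const-1 []       = refl
length≡sum-map-const-1 (x ∷ xs) = cong suc (length≡sum-map-const-1 xs)

sum-map-concatMap : ∀ {a b} {A : Set a} {B : Set b} (h : B → ℕ) (f : A → List B) xs →
                    sum (map h (concatMap f xs)) ≡ sum (map (λ x → sum (map h (f x))) xs)
sum-map-concatMap h f []       = refl
sum-map-concatMap h f (x ∷ xs) = begin
  sum (map h (f x ++ concatMap f xs))                 ≡⟨ cong sum (map-++ h (f x) (concatMap f xs)) ⟩
  sum (map h (f x) ++ map h (concatMap f xs))         ≡⟨ sum-++ (map h (f x)) _ ⟩
  sum (map h (f x)) + sum (map h (concatMap f xs))    ≡⟨ cong (sum (map h (f x)) +_) (sum-map-concatMap h f xs) ⟩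
  sum (map h (f x)) + sum (map (λ x → sum (map h (f x))) xs) ∎

sum-map-upTo : ∀ {a} {A : Set a} (h : A → ℕ) (f : ℕ → A) n → sum (map h (map f (upTo n))) ≡ ∑[ x < n ] h (f x)
sum-map-upTo h f n = trans (cong (sum ∘ map h) (map-upTo f n)) (go f n)
  where
  go : ∀ f n → sum (map h (applyUpTo f n)) ≡ ∑[ x < n ] h (f x)
  go f zero    = refl
  go f (suc n) = cong (h (f 0) +_) (go (f ∘ suc) n)

sum-over-indices : ∀ m (h : ℕ × ℕ → ℕ) →
  sum (map h (indices m)) ≡ ∑[ r < rowHigh m ∸ rowLow m ] ∑[ j < colHigh m ] h (rowLow m + r , j)
sum-over-indices m h = begin
  sum (map h (indices m))                                       ≡⟨ sum-map-concatMap h _ (rows m) ⟩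
  sum (map (λ i → sum (map h (map (i ,_) (cols m)))) (rows m)) ≡⟨ sum-map-upTo _ (rowLow m +_) (rowHigh m ∸ rowLow m) ⟩
  ∑[ r < rowHigh m ∸ rowLow m ] sum (map h (map (rowLow m + r ,_) (cols m)))
    ≡⟨ ∑-cong (rowHigh m ∸ rowLow m) (λ r _ → sum-map-upTo h (rowLow m + r ,_) (colHigh m)) ⟩
  ∑[ r < rowHigh m ∸ rowLow m ] ∑[ j < colHigh m ] h (rowLow m + r , j) ∎

entry-complement : ∀ i j → 𝟙 (does (entry i j ≟ 1)) + 𝟙 (binomOdd (suc i) j) ≡ 1
entry-complement i j = trans (cong (λ e → 𝟙 (does (e ≟ 1)) + 𝟙 odd?) entry≡) (complement odd?)
  where
  odd? = binomOdd (suc i) j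
  entry≡ : entry i j ≡ (𝟙 odd? + 1) % 2
  entry≡ = trans (%-distribˡ-+ ((suc i + j) C j) 1 2) (cong (λ x → (x + 1) % 2) (C-mod-2 (suc i + j) j))
  complement : ∀ b → 𝟙 (does ((𝟙 b + 1) % 2 ≟ 1)) + 𝟙 b ≡ 1
  complement true  = refl
  complement false = refl

oddEntries : ℕ → ℕ
oddEntries m = ∑[ r < rowHigh m ∸ rowLow m ] oddInRow (colHigh m) (suc (rowLow m + r))

numEntries≡∑∑1 : ∀ m → numEntries m ≡ ∑[ r < rowHigh m ∸ rowLow m ] ∑[ j < colHigh m ] 1
numEntries≡∑∑1 m = trans (length≡sum-map-const-1 (indices m)) (sum-over-indices m (const 1))

numOnes+oddEntries : ∀ m → numOnes m + oddEntries m ≡ numEntries m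
numOnes+oddEntries m = begin
  numOnes m + oddEntries m
    ≡⟨ cong (_+ oddEntries m) (trans (length-filter≡sum-map-𝟙 _ (indices m)) (sum-over-indices m _)) ⟩
  (∑[ r < R ] ∑[ j < N ] ones (low + r) j) + (∑[ r < R ] ∑[ j < N ] 𝟙 (binomOdd (suc (low + r)) j))
    ≡⟨ ∑-distrib-+ R _ _ ⟨
  ∑[ r < R ] ((∑[ j < N ] ones (low + r) j) + (∑[ j < N ] 𝟙 (binomOdd (suc (low + r)) j)))
    ≡⟨ ∑-cong R (λ r _ → ∑-distrib-+ N _ _) ⟨
  ∑[ r < R ] ∑[ j < N ] (ones (low + r) j + 𝟙 (binomOdd (suc (low + r)) j))
    ≡⟨ ∑-cong R (λ r _ → ∑-cong N (λ j _ → entry-complement (low + r) j)) ⟩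
  ∑[ r < R ] ∑[ j < N ] 1
    ≡⟨ numEntries≡∑∑1 m ⟨
  numEntries m ∎
  where
  R = rowHigh m ∸ rowLow m
  N = colHigh m
  low = rowLow m
  ones : ℕ → ℕ → ℕ
  ones i j = 𝟙 (does (entry i j ≟ 1))

rowCount : ∀ n → rowHigh (7 + n) ∸ rowLow (7 + n) ≡ 14 * 2 ^ n
rowCount n = trans (cong (λ x → x ∸ (x ∸ 14 * 2 ^ n)) (^-distribˡ-+-* 2 4 n))
                   (m∸[m∸n]≡n (*-monoˡ-≤ (2 ^ n) {14} {16} (m≤m+n 14 2)))

2^n*2^n≡4^n : ∀ n → 2 ^ n * 2 ^ n ≡ 4 ^ n
2^n*2^n≡4^n n = begin
  2 ^ n * 2 ^ n    ≡⟨ ^-distribˡ-+-* 2 n n ⟨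
  2 ^ (n + n)      ≡⟨ cong (λ k → 2 ^ (n + k)) (+-identityʳ n) ⟨
  2 ^ (2 * n)      ≡⟨ ^-*-assoc 2 2 n ⟨
  4 ^ n            ∎

numEntries-7+ : ∀ n → numEntries (7 + n) ≡ 14 * 4 ^ n
numEntries-7+ n = begin
  numEntries (7 + n)                       ≡⟨ numEntries≡∑∑1 (7 + n) ⟩
  ∑[ r < R ] ∑[ j < 2 ^ n ] 1              ≡⟨ cong (λ R → ∑[ r < R ] ∑[ j < 2 ^ n ] 1) (rowCount n) ⟩
  ∑[ r < 14 * 2 ^ n ] ∑[ j < 2 ^ n ] 1     ≡⟨ ∑-cong (14 * 2 ^ n) (λ _ _ → trans (∑-const (2 ^ n) 1) (*-identityʳ (2 ^ n))) ⟩
  ∑[ r < 14 * 2 ^ n ] (2 ^ n)              ≡⟨ ∑-const (14 * 2 ^ n) (2 ^ n) ⟩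
  14 * 2 ^ n * 2 ^ n                       ≡⟨ trans (*-assoc 14 (2 ^ n) (2 ^ n)) (cong (14 *_) (2^n*2^n≡4^n n)) ⟩
  14 * 4 ^ n                               ∎
  where R = rowHigh (7 + n) ∸ rowLow (7 + n)

oddEntries-7+ : ∀ n → oddEntries (7 + n) ≡ 14 * 3 ^ n
oddEntries-7+ n =
  trans (cong (λ R → ∑[ r < R ] oddInRow (2 ^ n) (suc (rowLow (7 + n) + r))) (rowCount n))
        (oddInConsecutiveRows n 14 (suc (rowLow (7 + n))))

numOnes-7+ : ∀ n → numOnes (7 + n) ≡ 14 * (4 ^ n ∸ 3 ^ n)
numOnes-7+ n = begin
  numOnes (7 + n)                                          ≡⟨ m+n∸n≡m (numOnes (7 + n)) (oddEntries (7 + n)) ⟨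
  numOnes (7 + n) + oddEntries (7 + n) ∸ oddEntries (7 + n) ≡⟨ cong₂ _∸_ (trans (numOnes+oddEntries (7 + n)) (numEntries-7+ n)) (oddEntries-7+ n) ⟩
  14 * 4 ^ n ∸ 14 * 3 ^ n                                  ≡⟨ *-distribˡ-∸ 14 (4 ^ n) (3 ^ n) ⟨
  14 * (4 ^ n ∸ 3 ^ n)                                     ∎

lemma4 : (m : ℕ) → 7 < m →
    numOnes m * 4 ^ (m ∸ 7) ≡ numEntries m * (4 ^ (m ∸ 7) ∸ 3 ^ (m ∸ 7))
lemma4 m 7<m = subst (λ m → numOnes m * 4 ^ (m ∸ 7) ≡ numEntries m * (4 ^ (m ∸ 7) ∸ 3 ^ (m ∸ 7)))
                     (m+[n∸m]≡n (<⇒≤ 7<m)) (crossMultiplied (m ∸ 7))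
  where
  crossMultiplied : ∀ n → numOnes (7 + n) * 4 ^ n ≡ numEntries (7 + n) * (4 ^ n ∸ 3 ^ n)
  crossMultiplied n = begin
    numOnes (7 + n) * 4 ^ n          ≡⟨ cong (_* 4 ^ n) (numOnes-7+ n) ⟩
    14 * (4 ^ n ∸ 3 ^ n) * 4 ^ n     ≡⟨ *-assoc 14 (4 ^ n ∸ 3 ^ n) (4 ^ n) ⟩
    14 * ((4 ^ n ∸ 3 ^ n) * 4 ^ n)   ≡⟨ cong (14 *_) (*-comm (4 ^ n ∸ 3 ^ n) (4 ^ n)) ⟩
    14 * (4 ^ n * (4 ^ n ∸ 3 ^ n))   ≡⟨ *-assoc 14 (4 ^ n) (4 ^ n ∸ 3 ^ n) ⟨
    14 * 4 ^ n * (4 ^ n ∸ 3 ^ n)     ≡⟨ cong (_* (4 ^ n ∸ 3 ^ n)) (numEntries-7+ n) ⟨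
    numEntries (7 + n) * (4 ^ n ∸ 3 ^ n) ∎
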